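{- Let $G$ be a connected graph. If every biconnected component of $G$ induces a great graph, then $G$ is great.
   Context: Graphs are finite and simple. A cut-vertex of a connected graph is a vertex whose removal disconnects it; a biconnected component is a maximal connected subgraph without a cut-vertex. A connected ordering of the vertices of a connected graph is an ordering $v_1,\dots,v_n$ such that for every $i$ the subgraph induced by $v_1,\dots,v_i$ is connected. A connected graph $G$ is great if for every connected ordering $v_1,\dots,v_n$ of its vertices and every positive integer $i$, if $v_1$ is given colour $i$ and then $v_2,\dots,v_n$ are coloured in this order, each receiving the smallest positive integer not used by its already coloured neighbours (including $v_1$), then all of $v_2,\dots,v_n$ receive colours in $\{1,\dots,\chi(G)\}$. -}

module Defs where

open import Data.Nat using (ℕ; zero; suc; _≤_; _≡ᵇ_)
open import Data.Bool using (Bool; true; false; T; if_then_else_; _∨_)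
open import Data.Fin using (Fin)
open import Data.Fin.Subset using (Subset; _∈_; _∉_; _⊆_; ⊤)
open import Data.List using (List; []; _∷_; length; take)
open import Data.List.Relation.Unary.All using (All)
open import Data.List.Relation.Unary.Unique.Propositional using (Unique)
import Data.List.Membership.Propositional as LMem
open import Data.Product using (_×_; _,_; proj₁; proj₂; ∃)
open import Function.Bundles using (_⇔_)
open import Relation.Binary.PropositionalEquality using (_≡_; _≢_)
open import Relation.Nullary using (¬_)

record Graph : Set where
  field
    n      : ℕ
    adj    : Fin n → Fin n → Bool
    sym    : ∀ u v → adj u v ≡ adj v u
    irrefl : ∀ v → adj v v ≡ false

open Graph public

module _ (G : Graph) where

  Vertex : Set
  Vertex = Fin (n G)

  Adj : Vertex → Vertex → Set
  Adj u v = T (adj G u v)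

  data Walk (P : Vertex → Set) : Vertex → Vertex → Set where
    here : ∀ {u} → P u → Walk P u u
    step : ∀ {u v w} → P u → Adj u v → Walk P v w → Walk P u w

  -- G[P] is connected (the empty graph counts as connected).
  ConnectedOn : (Vertex → Set) → Set
  ConnectedOn P = ∀ u v → P u → P v → Walk P u v

  ConnectedSub : Subset (n G) → Set
  ConnectedSub S = ConnectedOn (_∈ S)

  Connected : Set
  Connected = ConnectedSub ⊤

  IsCutVertex : Subset (n G) → Vertex → Set
  IsCutVertex S v = v ∈ S × ¬ ConnectedOn (λ u → u ∈ S × u ≢ v)

  ConnectedNoCut : Subset (n G) → Set
  ConnectedNoCut S = ConnectedSub S × (∀ v → ¬ IsCutVertex S v)

  -- S is (the vertex set of) a biconnected component: maximal such set.
  -- (A maximal connected subgraph without cut-vertex is always induced,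
  --  so it is determined by its vertex set.)
  BiconnectedComponent : Subset (n G) → Set
  BiconnectedComponent S =
    ConnectedNoCut S × (∀ T → S ⊆ T → ConnectedNoCut T → T ⊆ S)

  Colourable : Subset (n G) → ℕ → Set
  Colourable S k = ∃ λ (c : Vertex → ℕ) →
    (∀ v → v ∈ S → 1 ≤ c v × c v ≤ k) ×
    (∀ u v → u ∈ S → v ∈ S → Adj u v → c u ≢ c v)

  IsChromaticNumber : Subset (n G) → ℕ → Set
  IsChromaticNumber S k = Colourable S k × (∀ m → Colourable S m → k ≤ m)


  ConnectedOrdering : Subset (n G) → List Vertex → Set
  ConnectedOrdering S ord =
    Unique ord ×
    (∀ v → (v Data.Fin.Subset.∈ S) ⇔ (v LMem.∈ ord)) ×
    (∀ i → ConnectedOn (λ v → v LMem.∈ take i ord))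

  memberᵇ : ℕ → List ℕ → Bool
  memberᵇ c []       = false
  memberᵇ c (x ∷ xs) = (c ≡ᵇ x) ∨ memberᵇ c xs

  search : ℕ → ℕ → List ℕ → ℕ
  search zero    c xs = c
  search (suc k) c xs = if memberᵇ c xs then search k (suc c) xs else c

  -- smallest positive integer not in xs (it lies in {1,…,length xs + 1})
  firstFree : List ℕ → ℕ
  firstFree xs = search (length xs) 1 xs

  nbrColours : Vertex → List (Vertex × ℕ) → List ℕ
  nbrColours v []             = []
  nbrColours v ((u , c) ∷ as) =
    if adj G u v then c ∷ nbrColours v as else nbrColours v as

  colourRest : List (Vertex × ℕ) → List Vertex → List ℕ
  colourRest acc []       = []
  colourRest acc (v ∷ vs) =
    let c = firstFree (nbrColours v acc) in c ∷ colourRest ((v , c) ∷ acc) vs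

  greedyRest : List Vertex → ℕ → List ℕ
  greedyRest []       i = []
  greedyRest (v ∷ vs) i = colourRest ((v , i) ∷ []) vs

  Great : Subset (n G) → Set
  Great S = ∀ k → IsChromaticNumber S k →
            ∀ ord → ConnectedOrdering S ord →
            ∀ i → 1 ≤ i →
            All (λ c → 1 ≤ c × c ≤ k) (greedyRest ord i)

-- Let v be a vertex coloured after the first one. Its connected prefix gives it an earlier
-- neighbour a, and the edge av lies in some biconnected component B. In a connected ordering,
-- once the order has entered B, every later vertex of B has all its earlier neighbours in B:
-- a path in the prefix from such a neighbour back to B, closed up through the new vertex,
-- is an ear of B, and blocks absorb their ears. Hence the greedy colouring of G restricted
-- to B is the greedy colouring of B along the restricted (still connected) ordering, started
-- from the colour of the first vertex of B, and v receives a colour at most χ(B) ≤ χ(G)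
-- because B is great. The block and χ(B) are obtained classically, which is harmless because
-- the conclusion c ≤ χ(G) is decidable.
module Submission where

open import Defs renaming (sym to adj-sym; irrefl to adj-irrefl)

open import Data.Bool using (true; false; T)
open import Data.Fin using (Fin)
open import Data.Fin.Properties using (_≟_)
open import Data.Fin.Subset using (Subset; ∣_∣; ⁅_⁆; _∪_; _⊃_; ⊥; ⊤)
  renaming (_∈_ to _∈ₛ_; _⊆_ to _⊆ₛ_)
open import Data.Fin.Subset.Properties
  using (∣p∣≤n; p⊂q⇒∣p∣<∣q∣; ⊆-trans; ∉⊥; ∈⊤; x∈⁅x⁆; x∈⁅y⁆⇒x≡y; p⊆p∪q; q⊆p∪q; x∈p∪q⁻; x∈p∪q⁺)
  renaming (_∈?_ to _∈ₛ?_)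
open import Data.List using (List; []; _∷_; _++_; map; filter; take; length)
open import Data.List.Properties using (filter-accept; filter-reject; filter-++; ++-assoc)
open import Data.List.Membership.Propositional using (_∈_; _∉_)
open import Data.List.Membership.Propositional.Properties
  using (∈-map⁺; ∈-++⁺ˡ; ∈-++⁺ʳ; ∈-++⁻; ∈-filter⁺; ∈-filter⁻; ∈-∃++)
open import Data.List.Relation.Unary.Any using (here; there; any?)
open import Data.List.Relation.Unary.All as All using (All; []; _∷_)
open import Data.List.Relation.Unary.All.Properties using (¬Any⇒All¬; map⁺)
open import Data.List.Relation.Unary.AllPairs using ([]; _∷_)
open import Data.List.Relation.Unary.Unique.Propositional using (Unique)
open import Data.List.Relation.Unary.Unique.Propositional.Properties using (filter⁺)
open import Data.Nat using (ℕ; zero; suc; _≤_; _<_; _∸_; _≤?_; z≤n; s≤s)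
open import Data.Nat.Properties using (≤-refl; ≤-trans; n≤1+n; <⇒≤; ≮⇒≥; ∸-monoʳ-<)
open import Data.Nat.Induction using (<-rec; <-wellFounded)
open import Data.Product using (Σ; ∃; _×_; _,_; proj₁; proj₂)
open import Data.Sum using (_⊎_; inj₁; inj₂)
import Data.Sum as Sum
open import Effect.Monad using (RawMonad)
open import Function using (_∘_)
open import Function.Bundles using (_⇔_; mk⇔; Equivalence)
open import Induction.WellFounded using (WellFounded; module Subrelation)
import Induction.WellFounded as WF
import Relation.Binary.Construct.On as On
open import Level using (0ℓ)
open import Relation.Nullary using (¬_; Dec; yes; no; contradiction)
open import Relation.Nullary.Decidable using (decidable-stable; ¬¬-excluded-middle)
open import Relation.Nullary.Negation using (DoubleNegation; ¬¬-Monad)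
open import Relation.Unary using (Decidable)
open import Relation.Binary.PropositionalEquality
  using (_≡_; _≢_; refl; sym; trans; cong; subst; module ≡-Reasoning)

open RawMonad (¬¬-Monad {a = 0ℓ}) using (_>>=_; _<$>_; pure)
open ≡-Reasoning

take-length-++ : ∀ {A : Set} (xs ys : List A) → take (length xs) (xs ++ ys) ≡ xs
take-length-++ []       ys = refl
take-length-++ (x ∷ xs) ys = cong (x ∷_) (take-length-++ xs ys)

take-filter : ∀ {A : Set} {P : A → Set} (P? : Decidable P) j xs →
              ∃ λ j′ → take j (filter P? xs) ≡ filter P? (take j′ xs)
take-filter P? zero    xs       = 0 , refl
take-filter P? (suc j) []       = 0 , refl
take-filter P? (suc j) (x ∷ xs) with P? x
... | yes px with take-filter P? j xs
...   | j′ , eq = suc j′ , trans (cong (x ∷_) eq) (sym (filter-accept P? px))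
take-filter P? (suc j) (x ∷ xs) | no ¬px with take-filter P? (suc j) xs
...   | j′ , eq = suc j′ , trans eq (sym (filter-reject P? ¬px))

unique-++⁻ʳ : ∀ {A : Set} (xs : List A) {ys} → Unique (xs ++ ys) → Unique ys
unique-++⁻ʳ []       ys! = ys!
unique-++⁻ʳ (x ∷ xs) (_ ∷ xsys!) = unique-++⁻ʳ xs xsys!

unique-++-disjoint : ∀ {A : Set} (xs : List A) {ys z} → Unique (xs ++ ys) → z ∈ xs → z ∉ ys
unique-++-disjoint (x ∷ xs) (x∉ ∷ _)    (here refl) z∈ys = All.lookup x∉ (∈-++⁺ʳ xs z∈ys) refl
unique-++-disjoint (x ∷ xs) (_ ∷ xsys!) (there z∈xs) z∈ys = unique-++-disjoint xs xsys! z∈xs z∈ys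

∈-∉⇒≢ : ∀ {A : Set} {xs : List A} {v z} → v ∈ xs → z ∉ xs → v ≢ z
∈-∉⇒≢ v∈xs z∉xs refl = z∉xs v∈xs

fromList : ∀ {n} → List (Fin n) → Subset n
fromList []       = ⊥
fromList (x ∷ xs) = ⁅ x ⁆ ∪ fromList xs

∈-fromList⁺ : ∀ {n} {x : Fin n} {xs} → x ∈ xs → x ∈ₛ fromList xs
∈-fromList⁺ {xs = y ∷ _} (here refl) = x∈p∪q⁺ (inj₁ (x∈⁅x⁆ y))
∈-fromList⁺ (there x∈xs) = x∈p∪q⁺ (inj₂ (∈-fromList⁺ x∈xs))

∈-fromList⁻ : ∀ {n} {x : Fin n} xs → x ∈ₛ fromList xs → x ∈ xs
∈-fromList⁻ []       x∈ = contradiction x∈ ∉⊥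
∈-fromList⁻ (y ∷ ys) x∈ with x∈p∪q⁻ ⁅ y ⁆ (fromList ys) x∈
... | inj₁ x∈y  = here (x∈⁅y⁆⇒x≡y y x∈y)
... | inj₂ x∈ys = there (∈-fromList⁻ ys x∈ys)

⊃-wellFounded : ∀ {n} → WellFounded (_⊃_ {n})
⊃-wellFounded {n} = Subrelation.wellFounded shrinks (On.wellFounded (λ S → n ∸ ∣ S ∣) <-wellFounded)
  where
  shrinks : ∀ {T S} → T ⊃ S → n ∸ ∣ T ∣ < n ∸ ∣ S ∣
  shrinks {T} S⊂T = ∸-monoʳ-< (p⊂q⇒∣p∣<∣q∣ S⊂T) (∣p∣≤n T)

¬¬-maximal-⊇ : ∀ {n} (P : Subset n → Set) {S} → P S →
               DoubleNegation (∃ λ M → S ⊆ₛ M × P M × (∀ T → M ⊆ₛ T → P T → T ⊆ₛ M))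
¬¬-maximal-⊇ {n} P {S} = WF.All.wfRec ⊃-wellFounded 0ℓ (λ S → P S → Result S) grow S
  where
  Result : Subset n → Set
  Result S = DoubleNegation (∃ λ M → S ⊆ₛ M × P M × (∀ T → M ⊆ₛ T → P T → T ⊆ₛ M))

  grow : ∀ S → (∀ {T} → T ⊃ S → P T → Result T) → P S → Result S
  grow S rec pS = ¬¬-excluded-middle >>= extend
    where
    extend : Dec (∃ λ T → T ⊃ S × P T) → Result S
    extend (yes (T , S⊂T , pT)) =
      (λ (M , T⊆M , rest) → M , (λ {_} → ⊆-trans (proj₁ S⊂T) T⊆M) , rest) <$> rec S⊂T pT
    extend (no unextendable) = pure (S , (λ {_} x∈S → x∈S) , pS , maximal)
      where
      maximal : ∀ T → S ⊆ₛ T → P T → T ⊆ₛ S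
      maximal T S⊆T pT {x} x∈T with x ∈ₛ? S
      ... | yes x∈S = x∈S
      ... | no  x∉S = contradiction (T , ((λ {y} → S⊆T {y}) , x , x∈T , x∉S) , pT) unextendable

¬¬-least : (P : ℕ → Set) {m : ℕ} → P m →
           DoubleNegation (∃ λ k → k ≤ m × P k × (∀ j → P j → k ≤ j))
¬¬-least P {m} = <-rec (λ m → P m → Result m) shrink m
  where
  Result : ℕ → Set
  Result m = DoubleNegation (∃ λ k → k ≤ m × P k × (∀ j → P j → k ≤ j))

  shrink : ∀ m → (∀ {j} → j < m → P j → Result j) → P m → Result m
  shrink m rec pm = ¬¬-excluded-middle >>= descend
    where
    descend : Dec (∃ λ j → j < m × P j) → Result m
    descend (yes (j , j<m , pj)) =
      (λ (k , k≤j , rest) → k , ≤-trans k≤j (<⇒≤ j<m) , rest) <$> rec j<m pj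
    descend (no nothing-smaller) =
      pure (m , ≤-refl , pm , λ j pj → ≮⇒≥ λ j<m → nothing-smaller (j , j<m , pj))

module _ (G : Graph) where

  private
    V : Set
    V = Vertex G

  Adj-sym : ∀ {u v} → Adj G u v → Adj G v u
  Adj-sym {u} {v} = subst T (adj-sym G u v)

  Adj-irrefl : ∀ {v} → ¬ Adj G v v
  Adj-irrefl {v} = subst T (adj-irrefl G v)

  Colourable-⊆ : ∀ {S T k} → S ⊆ₛ T → Colourable G T k → Colourable G S k
  Colourable-⊆ S⊆T (c , range , proper) =
    c , (λ v v∈S → range v (S⊆T v∈S)) , (λ u v u∈S v∈S → proper u v (S⊆T u∈S) (S⊆T v∈S))

  -- Walks

  support : ∀ {P u v} → Walk G P u v → List V
  support (here {u} _)     = u ∷ []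
  support (step {u} _ _ w) = u ∷ support w

  start∈support : ∀ {P u v} (w : Walk G P u v) → u ∈ support w
  start∈support (here _)     = here refl
  start∈support (step _ _ _) = here refl

  end∈support : ∀ {P u v} (w : Walk G P u v) → v ∈ support w
  end∈support (here _)     = here refl
  end∈support (step _ _ w) = there (end∈support w)

  start-satisfies : ∀ {P u v} → Walk G P u v → P u
  start-satisfies (here pu)     = pu
  start-satisfies (step pu _ _) = pu

  support-All : ∀ {P u v} (w : Walk G P u v) → All P (support w)
  support-All (here pu)     = pu ∷ []
  support-All (step pu _ w) = pu ∷ support-All w

  relabel : ∀ {P Q u v} (w : Walk G P u v) → All Q (support w) → Walk G Q u v
  relabel (here _)     (qu ∷ _)  = here qu
  relabel (step _ e w) (qu ∷ qs) = step qu e (relabel w qs)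

  support-relabel : ∀ {P Q u v} (w : Walk G P u v) (qs : All Q (support w)) →
                    support (relabel w qs) ≡ support w
  support-relabel (here _)     (_ ∷ _)  = refl
  support-relabel (step _ _ w) (_ ∷ qs) = cong (_ ∷_) (support-relabel w qs)

  weaken : ∀ {P Q : V → Set} {u v} → (∀ {x} → P x → Q x) → Walk G P u v → Walk G Q u v
  weaken P⊆Q w = relabel w (All.map P⊆Q (support-All w))

  _++ʷ_ : ∀ {P u v w} → Walk G P u v → Walk G P v w → Walk G P u w
  here _       ++ʷ w′ = w′
  step pu e w  ++ʷ w′ = step pu e (w ++ʷ w′)

  reverseʷ : ∀ {P u v} → Walk G P u v → Walk G P v u
  reverseʷ (here pu)     = here pu
  reverseʷ (step pu e w) = reverseʷ w ++ʷ step (start-satisfies w) (Adj-sym e) (here pu)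

  record Splitting {P x y} (w : Walk G P x y) (u : V) : Set where
    constructor splitting
    field
      before          : List V
      initial         : Walk G P x u
      final           : Walk G P u y
      support-initial : support initial ≡ before ++ u ∷ []
      support-final   : support w ≡ before ++ support final

  open Splitting

  split : ∀ {P x y u} (w : Walk G P x y) → u ∈ support w → Splitting w u
  split (here pu)          (here refl)  = splitting [] (here pu) (here pu) refl refl
  split w@(step pu _ _)    (here refl)  = splitting [] (here pu) w refl refl
  split (step {x} px e w)  (there u∈w) =
    let s = split w u∈w in
    splitting (x ∷ before s) (step px e (initial s)) (final s)
              (cong (x ∷_) (support-initial s)) (cong (x ∷_) (support-final s))

  module _ {P x y u} {w : Walk G P x y} (s : Splitting w u) where

    final⊆ : ∀ {v} → v ∈ support (final s) → v ∈ support w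
    final⊆ {v} v∈ = subst (v ∈_) (sym (support-final s)) (∈-++⁺ʳ (before s) v∈)

    initial⊆ : ∀ {v} → v ∈ support (initial s) → v ∈ support w
    initial⊆ {v} v∈ with ∈-++⁻ (before s) (subst (v ∈_) (support-initial s) v∈)
    ... | inj₁ v∈before   = subst (v ∈_) (sym (support-final s)) (∈-++⁺ˡ v∈before)
    ... | inj₂ (here refl) = final⊆ (start∈support (final s))

    initial∩final≡split-point : Unique (support w) → ∀ {v} →
                                v ∈ support (initial s) → v ∈ support (final s) → v ≡ u
    initial∩final≡split-point w! {v} v∈initial v∈final
      with ∈-++⁻ (before s) (subst (v ∈_) (support-initial s) v∈initial)
    ... | inj₁ v∈before    = contradiction v∈final
                               (unique-++-disjoint (before s) (subst Unique (support-final s) w!) v∈before)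
    ... | inj₂ (here refl) = refl

  Path : (V → Set) → V → V → Set
  Path P u v = Σ (Walk G P u v) λ w → Unique (support w)

  walk⇒path : ∀ {P u v} → Walk G P u v → Path P u v
  walk⇒path (here pu) = here pu , [] ∷ []
  walk⇒path (step {u} pu e w) with walk⇒path w
  ... | w′ , w′! with any? (u ≟_) (support w′)
  ...   | yes u∈w′ = final s , unique-++⁻ʳ (before s) (subst Unique (support-final s) w′!)
    where s = split w′ u∈w′
  ...   | no  u∉w′ = step pu e w′ , ¬Any⇒All¬ (support w′) u∉w′ ∷ w′!

  connected-by-reaching : ∀ {P R : V → Set} → ConnectedOn G R → (∀ {u} → R u → P u) →
                          (∀ u → P u → ∃ λ t → R t × Walk G P u t) → ConnectedOn G P
  connected-by-reaching R-connected R⊆P reach u v pu pv with reach u pu | reach v pv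
  ... | s , rs , u→s | t , rt , v→t = u→s ++ʷ (weaken R⊆P (R-connected s t rs rt) ++ʷ reverseʷ v→t)

  -- Biconnected components

  edge-connectedNoCut : ∀ {a v} → Adj G a v → ConnectedNoCut G (⁅ a ⁆ ∪ ⁅ v ⁆)
  edge-connectedNoCut {a} {v} a~v =
    (λ x y x∈ y∈ → walk x∈ y∈ x∈ y∈) ,
    (λ z (_ , disconnected) → disconnected λ x y x∈ y∈ → walk (proj₁ x∈) (proj₁ y∈) x∈ y∈)
    where
    endpoint : ∀ {x} → x ∈ₛ ⁅ a ⁆ ∪ ⁅ v ⁆ → x ≡ a ⊎ x ≡ v
    endpoint x∈ = Sum.map (x∈⁅y⁆⇒x≡y a) (x∈⁅y⁆⇒x≡y v) (x∈p∪q⁻ ⁅ a ⁆ ⁅ v ⁆ x∈)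

    along : ∀ {P x y} → x ≡ a ⊎ x ≡ v → y ≡ a ⊎ y ≡ v → P x → P y → Walk G P x y
    along (inj₁ refl) (inj₁ refl) px py = here px
    along (inj₁ refl) (inj₂ refl) px py = step px a~v (here py)
    along (inj₂ refl) (inj₁ refl) px py = step px (Adj-sym a~v) (here py)
    along (inj₂ refl) (inj₂ refl) px py = here px

    walk : ∀ {P x y} → x ∈ₛ ⁅ a ⁆ ∪ ⁅ v ⁆ → y ∈ₛ ⁅ a ⁆ ∪ ⁅ v ⁆ → P x → P y → Walk G P x y
    walk x∈ y∈ = along (endpoint x∈) (endpoint y∈)

  ear-connectedNoCut : ∀ {B Q x y} → ConnectedNoCut G B → (σ : Walk G Q x y) → Unique (support σ) →
                       x ∈ₛ B → y ∈ₛ B → ConnectedNoCut G (B ∪ fromList (support σ))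
  ear-connectedNoCut {B} {Q} {x} {y} (B-connected , B-noCut) σ σ! x∈B y∈B = connected , noCut
    where
    E : Subset (n G)
    E = B ∪ fromList (support σ)

    B⊆E : B ⊆ₛ E
    B⊆E = p⊆p∪q (fromList (support σ))

    σ⊆E : ∀ {v} → v ∈ support σ → v ∈ₛ E
    σ⊆E v∈σ = q⊆p∪q B (fromList (support σ)) (∈-fromList⁺ v∈σ)

    E⊆B∪σ : ∀ {v} → v ∈ₛ E → v ∈ₛ B ⊎ v ∈ support σ
    E⊆B∪σ v∈E = Sum.map₂ (∈-fromList⁻ (support σ)) (x∈p∪q⁻ B (fromList (support σ)) v∈E)

    connected : ConnectedSub G E
    connected = connected-by-reaching B-connected B⊆E reach
      where
      reach : ∀ u → u ∈ₛ E → ∃ λ t → t ∈ₛ B × Walk G (_∈ₛ E) u t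
      reach u u∈E with E⊆B∪σ u∈E
      ... | inj₁ u∈B = u , u∈B , here u∈E
      ... | inj₂ u∈σ = y , y∈B , relabel (final s) (All.tabulate (σ⊆E ∘ final⊆ s))
        where s = split σ u∈σ

    -- The ear minus z stays attached to B − z through whichever of its two halves avoids z.
    reach-avoiding : ∀ z u → u ∈ₛ E × u ≢ z → ∃ λ t → (t ∈ₛ B × t ≢ z) × Walk G (λ v → v ∈ₛ E × v ≢ z) u t
    reach-avoiding z u (u∈E , u≢z) with E⊆B∪σ u∈E
    ... | inj₁ u∈B = u , (u∈B , u≢z) , here (u∈E , u≢z)
    ... | inj₂ u∈σ with split σ u∈σ
    ...   | s with any? (z ≟_) (support (final s))
    ...     | no z∉final =
      y , (y∈B , ∈-∉⇒≢ (end∈support (final s)) z∉final) ,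
      relabel (final s) (All.tabulate λ v∈ → σ⊆E (final⊆ s v∈) , ∈-∉⇒≢ v∈ z∉final)
    ...     | yes z∈final =
      x , (x∈B , ∈-∉⇒≢ (start∈support (initial s)) z∉initial) ,
      reverseʷ (relabel (initial s) (All.tabulate λ v∈ → σ⊆E (initial⊆ s v∈) , ∈-∉⇒≢ v∈ z∉initial))
      where
      z∉initial : z ∉ support (initial s)
      z∉initial z∈initial = u≢z (sym (initial∩final≡split-point s σ! z∈initial z∈final))

    avoiding : ∀ z → ConnectedOn G (λ u → u ∈ₛ B × u ≢ z) → ConnectedOn G (λ u → u ∈ₛ E × u ≢ z)
    avoiding z B-z-connected =
      connected-by-reaching B-z-connected (λ (u∈B , u≢z) → B⊆E u∈B , u≢z) (reach-avoiding z)

    noCut : ∀ z → ¬ IsCutVertex G E z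
    noCut z (_ , E-z-disconnected) with z ∈ₛ? B
    ... | yes z∈B = B-noCut z (z∈B , E-z-disconnected ∘ avoiding z)
    ... | no  z∉B = E-z-disconnected (avoiding z λ u v (u∈B , _) (v∈B , _) →
                      weaken (λ w∈B → w∈B , λ { refl → z∉B w∈B }) (B-connected u v u∈B v∈B))

  block-contains-path : ∀ {B Q x y} → BiconnectedComponent G B → (σ : Walk G Q x y) → Unique (support σ) →
                        x ∈ₛ B → y ∈ₛ B → All (_∈ₛ B) (support σ)
  block-contains-path {B} (B-cnc , B-maximal) σ σ! x∈B y∈B =
    All.tabulate λ v∈σ → B-maximal _ (p⊆p∪q _) (ear-connectedNoCut B-cnc σ σ! x∈B y∈B)
                                     (q⊆p∪q B _ (∈-fromList⁺ v∈σ))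

  neighbour-in-block : ∀ {B pre u b w} → BiconnectedComponent G B → ConnectedOn G (_∈ pre) →
                       u ∉ pre → u ∈ₛ B → b ∈ pre → b ∈ₛ B → w ∈ pre → Adj G w u → w ∈ₛ B
  neighbour-in-block {B} {pre} {u} {b} {w} bc pre-connected u∉pre u∈B b∈pre b∈B w∈pre w~u
    with walk⇒path (pre-connected w b w∈pre b∈pre)
  ... | W , W! = All.lookup (block-contains-path bc σ σ! u∈B b∈B) (there (start∈support W′))
    where
    W′ : Walk G (_∈ u ∷ pre) w b
    W′ = weaken there W

    σ : Walk G (_∈ u ∷ pre) u b
    σ = step (here refl) (Adj-sym w~u) W′

    σ! : Unique (support σ)
    σ! = subst (λ L → Unique (u ∷ L)) (sym (support-relabel W _))
           (All.map (λ x∈pre u≡x → u∉pre (subst (_∈ pre) (sym u≡x) x∈pre)) (support-All W) ∷ W!)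

  -- Connected orderings

  prefix-connected : ∀ {S ord} → ConnectedOrdering G S ord → ∀ xs {ys} → ord ≡ xs ++ ys →
                     ConnectedOn G (_∈ xs)
  prefix-connected (_ , _ , prefixes) xs {ys} refl =
    subst (λ L → ConnectedOn G (_∈ L)) (take-length-++ xs ys) (prefixes (length xs))

  ∃-earlier-neighbour : ∀ {S ord} pre {v post b} → ConnectedOrdering G S ord → ord ≡ pre ++ v ∷ post →
                        b ∈ pre → ∃ λ a → a ∈ pre × Adj G v a
  ∃-earlier-neighbour pre {v} {post} co@(ord! , _) refl b∈pre =
    neighbour b∈pre (prefix-connected co (pre ++ v ∷ []) (sym (++-assoc pre (v ∷ []) post))
                       v _ (∈-++⁺ʳ pre (here refl)) (∈-++⁺ˡ b∈pre))
    where
    neighbour : ∀ {b} → b ∈ pre → Walk G (_∈ pre ++ v ∷ []) v b → ∃ λ a → a ∈ pre × Adj G v a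
    neighbour v∈pre (here _) = contradiction (here refl) (unique-++-disjoint pre ord! v∈pre)
    neighbour _ (step _ v~a rest) with ∈-++⁻ pre (start-satisfies rest)
    ... | inj₁ a∈pre       = _ , a∈pre , v~a
    ... | inj₂ (here refl) = contradiction v~a Adj-irrefl

  filter-ConnectedOrdering : ∀ {B S ord} → BiconnectedComponent G B → B ⊆ₛ S → ConnectedOrdering G S ord →
                             ConnectedOrdering G B (filter (_∈ₛ? B) ord)
  filter-ConnectedOrdering {B} {S} {ord} bc B⊆S (ord! , members , prefixes) =
    filter⁺ (_∈ₛ? B) ord! , members′ , prefixes′
    where
    members′ : ∀ v → v ∈ₛ B ⇔ v ∈ filter (_∈ₛ? B) ord
    members′ v = mk⇔ (λ v∈B → ∈-filter⁺ (_∈ₛ? B) (Equivalence.to (members v) (B⊆S v∈B)) v∈B)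
                     (proj₂ ∘ ∈-filter⁻ (_∈ₛ? B) {xs = ord})

    prefixes′ : ∀ j → ConnectedOn G (_∈ take j (filter (_∈ₛ? B) ord))
    prefixes′ j u w u∈ w∈ with take-filter (_∈ₛ? B) j ord
    ... | j′ , eq with ∈-filter⁻ (_∈ₛ? B) (subst (u ∈_) eq u∈) | ∈-filter⁻ (_∈ₛ? B) (subst (w ∈_) eq w∈)
    ...   | u∈pre , u∈B | w∈pre , w∈B with walk⇒path (prefixes j′ u w u∈pre w∈pre)
    ...     | W , W! = relabel W (All.zipWith kept (support-All W , block-contains-path bc W W! u∈B w∈B))
      where
      kept : ∀ {x} → x ∈ take j′ ord × x ∈ₛ B → x ∈ take j (filter (_∈ₛ? B) ord)
      kept (x∈pre , x∈B) = subst (_ ∈_) (sym eq) (∈-filter⁺ (_∈ₛ? B) x∈pre x∈B)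

  -- Greedy colouring

  colourOf : List (V × ℕ) → V → ℕ
  colourOf acc v = firstFree G (nbrColours G v acc)

  trace : List (V × ℕ) → List V → List (V × ℕ)
  trace acc []       = []
  trace acc (v ∷ vs) = (v , colourOf acc v) ∷ trace ((v , colourOf acc v) ∷ acc) vs

  greedyTrace : List V → ℕ → List (V × ℕ)
  greedyTrace []       i = []
  greedyTrace (v ∷ vs) i = (v , i) ∷ trace ((v , i) ∷ []) vs

  colourRest≡trace : ∀ acc vs → colourRest G acc vs ≡ map proj₂ (trace acc vs)
  colourRest≡trace acc []       = refl
  colourRest≡trace acc (v ∷ vs) = cong (colourOf acc v ∷_) (colourRest≡trace _ vs)

  search-≥ : ∀ k c xs → c ≤ search G k c xs
  search-≥ zero    c xs = ≤-refl
  search-≥ (suc k) c xs with memberᵇ G c xs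
  ... | true  = ≤-trans (n≤1+n c) (search-≥ k (suc c) xs)
  ... | false = ≤-refl

  colourOf-positive : ∀ acc v → 1 ≤ colourOf acc v
  colourOf-positive acc v = search-≥ (length (nbrColours G v acc)) 1 (nbrColours G v acc)

  trace-positive : ∀ acc vs → All (λ p → 1 ≤ proj₂ p) (trace acc vs)
  trace-positive acc []       = []
  trace-positive acc (v ∷ vs) = colourOf-positive acc v ∷ trace-positive _ vs

  ∈-trace⁻ : ∀ {acc vs v c} → (v , c) ∈ trace acc vs → v ∈ vs
  ∈-trace⁻ {vs = _ ∷ _} (here refl) = here refl
  ∈-trace⁻ {vs = _ ∷ _} (there m)   = there (∈-trace⁻ m)

  ∈-greedyRest : ∀ xs {v ys a c c₁} → Unique (xs ++ v ∷ ys) → a ∈ xs →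
                 (v , c) ∈ greedyTrace (xs ++ v ∷ ys) c₁ → c ∈ greedyRest G (xs ++ v ∷ ys) c₁
  ∈-greedyRest (x ∷ xs) (x∉ ∷ _) _ (here refl) = contradiction refl (All.lookup x∉ (∈-++⁺ʳ xs (here refl)))
  ∈-greedyRest (x ∷ xs) {v} {ys} _ _ (there m) =
    subst (_ ∈_) (sym (colourRest≡trace _ (xs ++ v ∷ ys))) (∈-map⁺ proj₂ m)

  module Restriction (B : Subset (n G)) where

    inB? : Decidable (_∈ₛ B)
    inB? = _∈ₛ? B

    inB-col? : Decidable (λ (p : V × ℕ) → proj₁ p ∈ₛ B)
    inB-col? p = proj₁ p ∈ₛ? B

    filterᴮ : List V → List V
    filterᴮ = filter inB?

    filterᴮ-col : List (V × ℕ) → List (V × ℕ)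
    filterᴮ-col = filter inB-col?

    Meets : (V → Set) → Set
    Meets P = ∃ λ b → P b × b ∈ₛ B

    Meets-mono : ∀ {P Q} → (∀ {x} → P x → Q x) → Meets P → Meets Q
    Meets-mono P⊆Q (b , pb , b∈B) = b , P⊆Q pb , b∈B

    ClosedAt : (V → Set) → V → Set
    ClosedAt P u = u ∈ₛ B → Meets P → ∀ {w} → P w → Adj G w u → w ∈ₛ B

    ClosedAt-mono : ∀ {P Q u} → (∀ {x} → P x → Q x) → ClosedAt Q u → ClosedAt P u
    ClosedAt-mono P⊆Q closed u∈B meets pw = closed u∈B (Meets-mono P⊆Q meets) (P⊆Q pw)

    -- E are the vertices already coloured (latest first), vs those still to come.
    Closed : List V → List V → Set
    Closed E vs = ∀ p u q → vs ≡ p ++ u ∷ q → ClosedAt (λ x → x ∈ E ⊎ x ∈ p) u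

    Closed-∷ : ∀ {E u vs} → Closed E (u ∷ vs) → ClosedAt (_∈ E) u × Closed (u ∷ E) vs
    Closed-∷ {E} {u} closed =
      ClosedAt-mono inj₁ (closed [] u _ refl) ,
      λ p u′ q eq → ClosedAt-mono shift (closed (u ∷ p) u′ q (cong (u ∷_) eq))
      where
      shift : ∀ {x p} → x ∈ u ∷ E ⊎ x ∈ p → x ∈ E ⊎ x ∈ u ∷ p
      shift (inj₁ (here x≡u))  = inj₂ (here x≡u)
      shift (inj₁ (there x∈E)) = inj₁ x∈E
      shift (inj₂ x∈p)         = inj₂ (there x∈p)

    nbrColours-filterᴮ-col : ∀ u acc → (∀ {w c} → (w , c) ∈ acc → Adj G w u → w ∈ₛ B) →
                             nbrColours G u acc ≡ nbrColours G u (filterᴮ-col acc)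
    nbrColours-filterᴮ-col u []              _      = refl
    nbrColours-filterᴮ-col u ((w , c) ∷ acc) nbrs∈B with w ∈ₛ? B
    ... | yes _ with adj G w u
    ...   | true  = cong (c ∷_) (nbrColours-filterᴮ-col u acc (nbrs∈B ∘ there))
    ...   | false = nbrColours-filterᴮ-col u acc (nbrs∈B ∘ there)
    nbrColours-filterᴮ-col u ((w , c) ∷ acc) nbrs∈B | no w∉B with adj G w u | nbrs∈B (here refl)
    ...   | true  | w∈B = contradiction (w∈B _) w∉B
    ...   | false | _   = nbrColours-filterᴮ-col u acc (nbrs∈B ∘ there)

    filter-trace : ∀ acc vs → Meets (_∈ map proj₁ acc) → Closed (map proj₁ acc) vs →
                   filterᴮ-col (trace acc vs) ≡ trace (filterᴮ-col acc) (filterᴮ vs)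
    filter-trace acc []       _     _      = refl
    filter-trace acc (u ∷ vs) meets closed with Closed-∷ closed | u ∈ₛ? B
    ... | closedAt , closed′ | yes u∈B = begin
      (u , c) ∷ filterᴮ-col (trace acc′ vs)
        ≡⟨ cong ((u , c) ∷_) (filter-trace acc′ vs (Meets-mono there meets) closed′) ⟩
      (u , c) ∷ trace (filterᴮ-col acc′) (filterᴮ vs)
        ≡⟨ cong (λ a → (u , c) ∷ trace a (filterᴮ vs)) (filter-accept inB-col? u∈B) ⟩
      (u , c) ∷ trace ((u , c) ∷ filterᴮ-col acc) (filterᴮ vs)
        ≡⟨ cong (λ c → (u , c) ∷ trace ((u , c) ∷ filterᴮ-col acc) (filterᴮ vs)) same-colour ⟩
      trace (filterᴮ-col acc) (u ∷ filterᴮ vs) ∎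
      where
      c    = colourOf acc u
      acc′ = (u , c) ∷ acc
      same-colour : c ≡ colourOf (filterᴮ-col acc) u
      same-colour = cong (firstFree G)
        (nbrColours-filterᴮ-col u acc λ m w~u → closedAt u∈B meets (∈-map⁺ proj₁ m) w~u)
    ... | _ , closed′ | no u∉B = begin
      filterᴮ-col (trace acc′ vs)
        ≡⟨ filter-trace acc′ vs (Meets-mono there meets) closed′ ⟩
      trace (filterᴮ-col acc′) (filterᴮ vs)
        ≡⟨ cong (λ a → trace a (filterᴮ vs)) (filter-reject inB-col? u∉B) ⟩
      trace (filterᴮ-col acc) (filterᴮ vs) ∎
      where
      acc′ = (u , colourOf acc u) ∷ acc

    filter-trace-entering : ∀ acc u c vs → u ∈ₛ B → filterᴮ-col acc ≡ [] →
                            Closed (u ∷ map proj₁ acc) vs →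
                            filterᴮ-col (trace ((u , c) ∷ acc) vs) ≡ trace ((u , c) ∷ []) (filterᴮ vs)
    filter-trace-entering acc u c vs u∈B acc∉B closed = begin
      filterᴮ-col (trace ((u , c) ∷ acc) vs)
        ≡⟨ filter-trace _ vs (u , here refl , u∈B) closed ⟩
      trace (filterᴮ-col ((u , c) ∷ acc)) (filterᴮ vs)
        ≡⟨ cong (λ a → trace a (filterᴮ vs)) (filter-accept inB-col? u∈B) ⟩
      trace ((u , c) ∷ filterᴮ-col acc) (filterᴮ vs)
        ≡⟨ cong (λ a → trace ((u , c) ∷ a) (filterᴮ vs)) acc∉B ⟩
      trace ((u , c) ∷ []) (filterᴮ vs) ∎

    filter-trace-unentered : ∀ acc vs → filterᴮ-col acc ≡ [] → Closed (map proj₁ acc) vs →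
                             ∃ λ c → 1 ≤ c × filterᴮ-col (trace acc vs) ≡ greedyTrace (filterᴮ vs) c
    filter-trace-unentered acc []       _     _      = 1 , s≤s z≤n , refl
    filter-trace-unentered acc (u ∷ vs) acc∉B closed with u ∈ₛ? B
    ... | yes u∈B = colourOf acc u , colourOf-positive acc u ,
                    cong (_ ∷_) (filter-trace-entering acc u _ vs u∈B acc∉B (proj₂ (Closed-∷ closed)))
    ... | no u∉B = filter-trace-unentered ((u , colourOf acc u) ∷ acc) vs
                     (trans (filter-reject inB-col? u∉B) acc∉B) (proj₂ (Closed-∷ closed))

    filter-greedyTrace : ∀ v vs i → 1 ≤ i → Closed (v ∷ []) vs →
                         ∃ λ c → 1 ≤ c ×
                                 filterᴮ-col (greedyTrace (v ∷ vs) i) ≡ greedyTrace (filterᴮ (v ∷ vs)) c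
    filter-greedyTrace v vs i i≥1 closed with v ∈ₛ? B
    ... | yes v∈B = i , i≥1 , cong (_ ∷_) (filter-trace-entering [] v i vs v∈B refl closed)
    ... | no v∉B = filter-trace-unentered ((v , i) ∷ []) vs (filter-reject inB-col? v∉B) closed

  open Restriction

  ordering-Closed : ∀ {B S v₁ rest} → BiconnectedComponent G B → ConnectedOrdering G S (v₁ ∷ rest) →
                    Closed B (v₁ ∷ []) rest
  ordering-Closed {B} {v₁ = v₁} bc co@(ord! , _) p u q refl = ClosedAt-mono B into-prefix
    λ u∈B (_ , b∈ , b∈B) w∈ →
      neighbour-in-block bc (prefix-connected co (v₁ ∷ p) refl) u∉prefix u∈B b∈ b∈B w∈
    where
    into-prefix : ∀ {x} → x ∈ v₁ ∷ [] ⊎ x ∈ p → x ∈ v₁ ∷ p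
    into-prefix (inj₁ (here x≡v₁)) = here x≡v₁
    into-prefix (inj₂ x∈p)         = there x∈p

    u∉prefix : u ∉ v₁ ∷ p
    u∉prefix u∈ = unique-++-disjoint (v₁ ∷ p) ord! u∈ (here refl)

  greedy-colour-≤-block : ∀ {B kB v₁ rest i pre v post a c} → BiconnectedComponent G B → Great G B →
                          IsChromaticNumber G B kB → ConnectedOrdering G ⊤ (v₁ ∷ rest) → 1 ≤ i →
                          v₁ ∷ rest ≡ pre ++ v ∷ post → a ∈ pre → a ∈ₛ B → v ∈ₛ B →
                          (v , c) ∈ greedyTrace (v₁ ∷ rest) i → c ≤ kB
  greedy-colour-≤-block {B} {kB} {v₁} {rest} {i} {pre} {v} {post} {a} {c}
                        bc great χB co i≥1 ord≡ a∈pre a∈B v∈B mem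
    with filter-greedyTrace B v₁ rest i i≥1 (ordering-Closed bc co)
  ... | c₁ , c₁≥1 , filter≡ =
    proj₂ (All.lookup (great kB χB _ (filter-ConnectedOrdering bc (λ _ → ∈⊤) co) c₁ c₁≥1) c∈greedyRest)
    where
    ordᴮ≡ : filterᴮ B (v₁ ∷ rest) ≡ filterᴮ B pre ++ v ∷ filterᴮ B post
    ordᴮ≡ = begin
      filterᴮ B (v₁ ∷ rest)                 ≡⟨ cong (filterᴮ B) ord≡ ⟩
      filterᴮ B (pre ++ v ∷ post)           ≡⟨ filter-++ (inB? B) pre (v ∷ post) ⟩
      filterᴮ B pre ++ filterᴮ B (v ∷ post) ≡⟨ cong (filterᴮ B pre ++_) (filter-accept (inB? B) v∈B) ⟩
      filterᴮ B pre ++ v ∷ filterᴮ B post   ∎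

    memᴮ : (v , c) ∈ greedyTrace (filterᴮ B pre ++ v ∷ filterᴮ B post) c₁
    memᴮ = subst (λ L → (v , c) ∈ greedyTrace L c₁) ordᴮ≡
             (subst ((v , c) ∈_) filter≡ (∈-filter⁺ (inB-col? B) mem v∈B))

    c∈greedyRest : c ∈ greedyRest G (filterᴮ B (v₁ ∷ rest)) c₁
    c∈greedyRest = subst (λ L → c ∈ greedyRest G L c₁) (sym ordᴮ≡)
      (∈-greedyRest (filterᴮ B pre) (subst Unique ordᴮ≡ (filter⁺ (inB? B) (proj₁ co)))
                    (∈-filter⁺ (inB? B) a∈pre a∈B) memᴮ)

  greedy-colour-≤ : ∀ {k v₁ rest i r v r₂ c} → (∀ S → BiconnectedComponent G S → Great G S) →
                    IsChromaticNumber G ⊤ k → ConnectedOrdering G ⊤ (v₁ ∷ rest) → 1 ≤ i →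
                    rest ≡ r ++ v ∷ r₂ → (v , c) ∈ greedyTrace (v₁ ∷ rest) i → c ≤ k
  greedy-colour-≤ {k} {v₁} {r = r} {v} {c = c} hyp (G-colourable , _) co i≥1 refl mem
    with ∃-earlier-neighbour (v₁ ∷ r) co refl (here refl)
  ... | a , a∈pre , v~a = decidable-stable (c ≤? k) (
    ¬¬-maximal-⊇ (ConnectedNoCut G) (edge-connectedNoCut (Adj-sym v~a)) >>= λ (B , edge⊆B , bc) →
    ¬¬-least (Colourable G B) (Colourable-⊆ (λ _ → ∈⊤) G-colourable)   >>= λ (kB , kB≤k , χB) →
    pure (≤-trans (greedy-colour-≤-block bc (hyp B bc) χB co i≥1 refl a∈pre
                     (edge⊆B (x∈p∪q⁺ (inj₁ (x∈⁅x⁆ a)))) (edge⊆B (x∈p∪q⁺ (inj₂ (x∈⁅x⁆ v)))) mem)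
                  kB≤k))

lemma1 : ∀ (G : Graph) → Connected G →
    (∀ S → BiconnectedComponent G S → Great G S) →
    Great G ⊤
lemma1 G _ hyp k χ []          co i i≥1 = []
lemma1 G _ hyp k χ (v₁ ∷ rest) co i i≥1 =
  subst (All (λ c → 1 ≤ c × c ≤ k)) (sym (colourRest≡trace G ((v₁ , i) ∷ []) rest))
    (map⁺ (All.tabulate λ m → All.lookup (trace-positive G _ rest) m , bound m))
  where
  bound : ∀ {v c} → (v , c) ∈ trace G ((v₁ , i) ∷ []) rest → c ≤ k
  bound m with ∈-∃++ (∈-trace⁻ G m)
  ... | r , r₂ , rest≡ = greedy-colour-≤ G hyp χ co i≥1 rest≡ (there m)
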